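{- For any string form $I$ with $I\subseteq I_0$ there is a string form $J\subseteq I$ such that $QT^+\vdash\forall x_2,y_1,y_2\in J\ \forall x_1,z_1,z_2\,(\mathrm{Tally}_b(x_2)\wedge\mathrm{Tally}_b(y_1)\wedge\mathrm{Tally}_b(y_2)\wedge\mathrm{Addtally}(x_1,x_2,z_1)\wedge\mathrm{Addtally}(y_1,y_2,z_2)\wedge x_1\le y_1\wedge z_1=Sz_2\to Sy_2\le x_2)$.
   Context: $QT^+$ is the first-order theory in the language $\{a,b,*,S\}$ with axioms the universal closures of: (QT1) $x*(y*z)=(x*y)*z$; (QT2) $\neg(x*y=a)\wedge\neg(x*y=b)$; (QT3) $(x*a=y*a\to x=y)\wedge(x*b=y*b\to x=y)\wedge(a*x=a*y\to x=y)\wedge(b*x=b*y\to x=y)$; (QT4) $\neg(a*x=b*y)\wedge\neg(x*a=y*b)$; (QT5) $x=a\vee x=b\vee(\exists y(a*y=x\vee b*y=x)\wedge\exists z(z*a=x\vee z*b=x))$; (QT6) $Sx=y\leftrightarrow((x=a\wedge y=b)\vee(\neg x=a\wedge x*b=y))$. A string form is a formula $I(x)$ of this language with $QT^+\vdash I(a)$, $QT^+\vdash I(b)$, $QT^+\vdash I(x)\to I(x*a)$ and $QT^+\vdash I(x)\to I(x*b)$. For string forms (or formulas) $J,I$, $J\subseteq I$ means $QT^+\vdash\forall x(J(x)\to I(x))$. $\forall x\in J\,\varphi$ abbreviates $\forall x(J(x)\to\varphi)$. Abbreviations: $xBy\equiv\exists z\,(x*z=y)$; $xEy\equiv\exists z\,(z*x=y)$;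 $x\subseteq_p y\equiv x=y\vee xBy\vee xEy\vee\exists y_1\exists y_2\,(y=y_1*(x*y_2))$; $\mathrm{Tally}_b(x)\equiv\forall y\,(y\subseteq_p x\wedge(y=a\vee y=b)\to y=b)$; $xRy\equiv(x=a\wedge\neg y=a)\vee xBy$; $I_0(x)\equiv\forall y\,((yRx\vee y=x)\to\neg yRy)$; $x<y\equiv I_0(x)\wedge I_0(y)\wedge xRy$; $x\le y\equiv x<y\vee x=y$. $\mathrm{Addtally}(x,y,z)$ abbreviates: $(\mathrm{Tally}_b(x)\wedge\mathrm{Tally}_b(y)\wedge((x=b\wedge z=y)\vee(y=b\wedge z=x)\vee\exists x_1,y_1(\mathrm{Tally}_b(x_1)\wedge x=Sx_1\wedge\mathrm{Tally}_b(y_1)\wedge y=Sy_1\wedge z=x*y_1))))\vee((\neg\mathrm{Tally}_b(x)\vee\neg\mathrm{Tally}_b(y))\wedge z=b)$. -}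

module Defs where

open import Data.Nat using (ℕ; zero; suc)
open import Data.Fin using (Fin; zero; suc; #_)
open import Data.List using (List; []; _∷_; map)
open import Data.List.Membership.Propositional using (_∈_)
open import Data.Product using (Σ; _×_; _,_)

-- Syntax of the language {a, b, *, S}: well-scoped de Bruijn terms and
-- formulas (n = number of free variables in scope; var zero is the
-- innermost bound variable).

infixl 9 _*_
infix  6 _≐_
infixr 5 _∧_
infixr 4 _∨_
infixr 3 _⇒_
infix  2 _⇔_

data Term (n : ℕ) : Set where
  var : Fin n → Term n
  a   : Term n
  b   : Term n
  _*_ : Term n → Term n → Term n
  S   : Term n → Term n

data Formula (n : ℕ) : Set where
  _≐_ : Term n → Term n → Formula n
  ⊥'  : Formula n
  _⇒_ : Formula n → Formula n → Formula n
  _∧_ : Formula n → Formula n → Formula n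
  _∨_ : Formula n → Formula n → Formula n
  ∀'  : Formula (suc n) → Formula n
  ∃'  : Formula (suc n) → Formula n

¬' : ∀ {n} → Formula n → Formula n
¬' φ = φ ⇒ ⊥'

_⇔_ : ∀ {n} → Formula n → Formula n → Formula n
φ ⇔ ψ = (φ ⇒ ψ) ∧ (ψ ⇒ φ)

Ren : ℕ → ℕ → Set
Ren m n = Fin m → Fin n

extR : ∀ {m n} → Ren m n → Ren (suc m) (suc n)
extR ρ zero    = zero
extR ρ (suc i) = suc (ρ i)

renT : ∀ {m n} → Ren m n → Term m → Term n
renT ρ (var i) = var (ρ i)
renT ρ a       = a
renT ρ b       = b
renT ρ (s * t) = renT ρ s * renT ρ t
renT ρ (S t)   = S (renT ρ t)

renF : ∀ {m n} → Ren m n → Formula m → Formula n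
renF ρ (s ≐ t) = renT ρ s ≐ renT ρ t
renF ρ ⊥'      = ⊥'
renF ρ (φ ⇒ ψ) = renF ρ φ ⇒ renF ρ ψ
renF ρ (φ ∧ ψ) = renF ρ φ ∧ renF ρ ψ
renF ρ (φ ∨ ψ) = renF ρ φ ∨ renF ρ ψ
renF ρ (∀' φ)  = ∀' (renF (extR ρ) φ)
renF ρ (∃' φ)  = ∃' (renF (extR ρ) φ)

wk : ∀ {n} → Term n → Term (suc n)
wk = renT suc

wkF : ∀ {n} → Formula n → Formula (suc n)
wkF = renF suc

embed : ∀ {n} → Formula 0 → Formula n
embed = renF (λ ())

Sub : ℕ → ℕ → Set
Sub m n = Fin m → Term n

extS : ∀ {m n} → Sub m n → Sub (suc m) (suc n)
extS σ zero    = var zero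
extS σ (suc i) = wk (σ i)

subT : ∀ {m n} → Sub m n → Term m → Term n
subT σ (var i) = σ i
subT σ a       = a
subT σ b       = b
subT σ (s * t) = subT σ s * subT σ t
subT σ (S t)   = S (subT σ t)

subF : ∀ {m n} → Sub m n → Formula m → Formula n
subF σ (s ≐ t) = subT σ s ≐ subT σ t
subF σ ⊥'      = ⊥'
subF σ (φ ⇒ ψ) = subF σ φ ⇒ subF σ ψ
subF σ (φ ∧ ψ) = subF σ φ ∧ subF σ ψ
subF σ (φ ∨ ψ) = subF σ φ ∨ subF σ ψ
subF σ (∀' φ)  = ∀' (subF (extS σ) φ)
subF σ (∃' φ)  = ∃' (subF (extS σ) φ)

_[_] : ∀ {n} → Formula (suc n) → Term n → Formula n
φ [ t ] = subF σ φ
  where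
  σ : Sub _ _
  σ zero    = t
  σ (suc i) = var i

app : ∀ {n} → Formula 1 → Term n → Formula n
app I t = subF (λ _ → t) I

x3 y3 z3 : Term 3
x3 = var (# 2)
y3 = var (# 1)
z3 = var (# 0)

x2 y2 : Term 2
x2 = var (# 1)
y2 = var (# 0)

data QTAxiom : Formula 0 → Set where
  QT1 : QTAxiom (∀' (∀' (∀' (x3 * (y3 * z3) ≐ (x3 * y3) * z3))))
  QT2 : QTAxiom (∀' (∀' (¬' (x2 * y2 ≐ a) ∧ ¬' (x2 * y2 ≐ b))))
  QT3 : QTAxiom (∀' (∀' (((x2 * a ≐ y2 * a) ⇒ x2 ≐ y2)
                      ∧ ((x2 * b ≐ y2 * b) ⇒ x2 ≐ y2)
                      ∧ ((a * x2 ≐ a * y2) ⇒ x2 ≐ y2)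
                      ∧ ((b * x2 ≐ b * y2) ⇒ x2 ≐ y2))))
  QT4 : QTAxiom (∀' (∀' (¬' (a * x2 ≐ b * y2) ∧ ¬' (x2 * a ≐ y2 * b))))
  QT5 : QTAxiom (∀' (var zero ≐ a ∨ var zero ≐ b ∨
                     (∃' (a * var zero ≐ var (# 1) ∨ b * var zero ≐ var (# 1))
                      ∧ ∃' (var zero * a ≐ var (# 1) ∨ var zero * b ≐ var (# 1)))))
  QT6 : QTAxiom (∀' (∀' (S x2 ≐ y2 ⇔ ((x2 ≐ a ∧ y2 ≐ b) ∨ (¬' (x2 ≐ a) ∧ x2 * b ≐ y2)))))

infix 1 _⊢_

data _⊢_ : ∀ {n} → List (Formula n) → Formula n → Set where
  hyp   : ∀ {n} {Γ : List (Formula n)} {φ} → φ ∈ Γ → Γ ⊢ φ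
  ax    : ∀ {n} {Γ : List (Formula n)} {φ} → QTAxiom φ → Γ ⊢ embed φ
  ⇒I    : ∀ {n} {Γ : List (Formula n)} {φ ψ} → (φ ∷ Γ) ⊢ ψ → Γ ⊢ φ ⇒ ψ
  ⇒E    : ∀ {n} {Γ : List (Formula n)} {φ ψ} → Γ ⊢ φ ⇒ ψ → Γ ⊢ φ → Γ ⊢ ψ
  ∧I    : ∀ {n} {Γ : List (Formula n)} {φ ψ} → Γ ⊢ φ → Γ ⊢ ψ → Γ ⊢ φ ∧ ψ
  ∧E₁   : ∀ {n} {Γ : List (Formula n)} {φ ψ} → Γ ⊢ φ ∧ ψ → Γ ⊢ φ
  ∧E₂   : ∀ {n} {Γ : List (Formula n)} {φ ψ} → Γ ⊢ φ ∧ ψ → Γ ⊢ ψ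
  ∨I₁   : ∀ {n} {Γ : List (Formula n)} {φ ψ} → Γ ⊢ φ → Γ ⊢ φ ∨ ψ
  ∨I₂   : ∀ {n} {Γ : List (Formula n)} {φ ψ} → Γ ⊢ ψ → Γ ⊢ φ ∨ ψ
  ∨E    : ∀ {n} {Γ : List (Formula n)} {φ ψ χ} →
          Γ ⊢ φ ∨ ψ → (φ ∷ Γ) ⊢ χ → (ψ ∷ Γ) ⊢ χ → Γ ⊢ χ
  raa   : ∀ {n} {Γ : List (Formula n)} {φ} → (¬' φ ∷ Γ) ⊢ ⊥' → Γ ⊢ φ
  ∀I    : ∀ {n} {Γ : List (Formula n)} {φ} → map wkF Γ ⊢ φ → Γ ⊢ ∀' φ
  ∀E    : ∀ {n} {Γ : List (Formula n)} {φ} → Γ ⊢ ∀' φ → (t : Term n) → Γ ⊢ φ [ t ]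
  ∃I    : ∀ {n} {Γ : List (Formula n)} {φ} (t : Term n) → Γ ⊢ φ [ t ] → Γ ⊢ ∃' φ
  ∃E    : ∀ {n} {Γ : List (Formula n)} {φ ψ} →
          Γ ⊢ ∃' φ → (φ ∷ map wkF Γ) ⊢ wkF ψ → Γ ⊢ ψ
  ≐refl : ∀ {n} {Γ : List (Formula n)} {t} → Γ ⊢ t ≐ t
  ≐subst : ∀ {n} {Γ : List (Formula n)} {s t} (φ : Formula (suc n)) →
          Γ ⊢ s ≐ t → Γ ⊢ φ [ s ] → Γ ⊢ φ [ t ]

QT⁺⊢_ : Formula 0 → Set
QT⁺⊢ φ = [] ⊢ φ

IsStringForm : Formula 1 → Set
IsStringForm I =
    (QT⁺⊢ app I a)
  × (QT⁺⊢ app I b)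
  × (QT⁺⊢ ∀' (I ⇒ app I (var zero * a)))
  × (QT⁺⊢ ∀' (I ⇒ app I (var zero * b)))

_⊆_ : Formula 1 → Formula 1 → Set
J ⊆ I = QT⁺⊢ ∀' (J ⇒ I)

_B_ : ∀ {n} → Term n → Term n → Formula n
x B y = ∃' (wk x * var zero ≐ wk y)

_E_ : ∀ {n} → Term n → Term n → Formula n
x E y = ∃' (var zero * wk x ≐ wk y)

_⊆p_ : ∀ {n} → Term n → Term n → Formula n
x ⊆p y = x ≐ y ∨ x B y ∨ x E y
       ∨ ∃' (∃' (wk (wk y) ≐ var (# 1) * (wk (wk x) * var zero)))

Tallyb : ∀ {n} → Term n → Formula n
Tallyb x = ∀' (((var zero ⊆p wk x) ∧ (var zero ≐ a ∨ var zero ≐ b)) ⇒ var zero ≐ b)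

_R_ : ∀ {n} → Term n → Term n → Formula n
x R y = (x ≐ a ∧ ¬' (y ≐ a)) ∨ x B y

I₀ : ∀ {n} → Term n → Formula n
I₀ x = ∀' ((var zero R wk x ∨ var zero ≐ wk x) ⇒ ¬' (var zero R var zero))

I₀F : Formula 1
I₀F = I₀ (var zero)

_<'_ : ∀ {n} → Term n → Term n → Formula n
x <' y = I₀ x ∧ I₀ y ∧ x R y

_≤'_ : ∀ {n} → Term n → Term n → Formula n
x ≤' y = x <' y ∨ x ≐ y

Addtally : ∀ {n} → Term n → Term n → Term n → Formula n
Addtally x y z =
  (Tallyb x ∧ Tallyb y ∧
    ((x ≐ b ∧ z ≐ y) ∨ (y ≐ b ∧ z ≐ x) ∨
     ∃' (∃' (Tallyb x₁ ∧ x' ≐ S x₁ ∧ Tallyb y₁ ∧ y' ≐ S y₁ ∧ z' ≐ x' * y₁))))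
  ∨ ((¬' (Tallyb x) ∨ ¬' (Tallyb y)) ∧ z ≐ b)
  where
  x₁ = var (# 1)
  y₁ = var (# 0)
  x' = wk (wk x)
  y' = wk (wk y)
  z' = wk (wk z)

thm7Body : Formula 6
thm7Body =
  (Tallyb X2 ∧ Tallyb Y1 ∧ Tallyb Y2 ∧ Addtally X1 X2 Z1 ∧ Addtally Y1 Y2 Z2
    ∧ X1 ≤' Y1 ∧ Z1 ≐ S Z2)
  ⇒ S Y2 ≤' X2
  where
  -- binding order: x₂, y₁, y₂, x₁, z₁, z₂ (z₂ innermost)
  X2 Y1 Y2 X1 Z1 Z2 : Term 6
  X2 = var (# 5)
  Y1 = var (# 4)
  Y2 = var (# 3)
  X1 = var (# 2)
  Z1 = var (# 1)
  Z2 = var (# 0)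

thm7Sentence : Formula 1 → Formula 0
thm7Sentence J =
  ∀' (app J (var zero) ⇒
  ∀' (app J (var zero) ⇒
  ∀' (app J (var zero) ⇒
  ∀' (∀' (∀' thm7Body)))))

{-# OPTIONS --safe #-}
-- Shorten I to J(x) := I(x) ∧ Good(x), where Good x says that every prefix of x is
-- left cancellable and, if a tally, commutes with b, and that x, if a tally, commutes
-- with everything commuting with b.  Both a and b are good and goodness survives
-- appending a or b, so J is again a string form.  For good tallies, Addtally(x, y, z)
-- gives z * b = x * y, so z₁ = S z₂ yields x₁ * x₂ = y₁ * (y₂ * b).  If x₁ = y₁,
-- cancelling y₁ gives x₂ = S y₂.  If y₁ = x₁ * w, then w commutes with b (as x₁ and y₁
-- do), so cancelling x₁ and moving w past y₂ * b gives x₂ = (S y₂) * w, i.e. S y₂ < x₂.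
-- The case x₁ = a is impossible: a is no tally, so z₁ = b, while z₁ = z₂ * b.

module Submission where

open import Defs
open import Data.Nat using (ℕ; zero; suc)
open import Data.Fin using (zero; suc)
open import Data.List using (List; []; _∷_; map)
open import Data.List.Membership.Propositional.Properties using (∈-map⁺)
open import Data.List.Relation.Binary.Subset.Propositional using () renaming (_⊆_ to _⊆ₗ_)
open import Data.List.Relation.Binary.Subset.Propositional.Properties using (map⁺; ∷⁺ʳ)
open import Data.List.Relation.Unary.Any using (here; there)
open import Data.Product using (Σ; _×_; _,_)
open import Function using (_∘_)
open import Relation.Binary.PropositionalEquality
  using (_≡_; refl; sym; trans; cong; cong₂; subst; subst₂; _≗_; module ≡-Reasoning)

-- Substitutions are written outermost variable first: ∅ₛ ▸ s ▸ t sends var 1 to s and var 0 to t.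
infixl 5 _▸_

_▸_ : ∀ {m n} → Sub m n → Term n → Sub (suc m) n
(σ ▸ t) zero    = t
(σ ▸ t) (suc i) = σ i

∅ₛ : ∀ {n} → Sub 0 n
∅ₛ ()

subT-cong : ∀ {m n} {σ τ : Sub m n} → σ ≗ τ → ∀ t → subT σ t ≡ subT τ t
subT-cong e (var i) = e i
subT-cong e a       = refl
subT-cong e b       = refl
subT-cong e (s * t) = cong₂ _*_ (subT-cong e s) (subT-cong e t)
subT-cong e (S t)   = cong S (subT-cong e t)

subT-id : ∀ {n} (t : Term n) → subT var t ≡ t
subT-id (var i) = refl
subT-id a       = refl
subT-id b       = refl
subT-id (s * t) = cong₂ _*_ (subT-id s) (subT-id t)
subT-id (S t)   = cong S (subT-id t)

subT-subT : ∀ {l m n} (σ : Sub m n) (τ : Sub l m) t →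
            subT σ (subT τ t) ≡ subT (subT σ ∘ τ) t
subT-subT σ τ (var i) = refl
subT-subT σ τ a       = refl
subT-subT σ τ b       = refl
subT-subT σ τ (s * t) = cong₂ _*_ (subT-subT σ τ s) (subT-subT σ τ t)
subT-subT σ τ (S t)   = cong S (subT-subT σ τ t)

subT-renT : ∀ {l m n} (σ : Sub m n) (ρ : Ren l m) t → subT σ (renT ρ t) ≡ subT (σ ∘ ρ) t
subT-renT σ ρ (var i) = refl
subT-renT σ ρ a       = refl
subT-renT σ ρ b       = refl
subT-renT σ ρ (s * t) = cong₂ _*_ (subT-renT σ ρ s) (subT-renT σ ρ t)
subT-renT σ ρ (S t)   = cong S (subT-renT σ ρ t)

renT-subT : ∀ {l m n} (ρ : Ren m n) (σ : Sub l m) t → renT ρ (subT σ t) ≡ subT (renT ρ ∘ σ) t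
renT-subT ρ σ (var i) = refl
renT-subT ρ σ a       = refl
renT-subT ρ σ b       = refl
renT-subT ρ σ (s * t) = cong₂ _*_ (renT-subT ρ σ s) (renT-subT ρ σ t)
renT-subT ρ σ (S t)   = cong S (renT-subT ρ σ t)

renT-as-subT : ∀ {m n} (ρ : Ren m n) t → renT ρ t ≡ subT (var ∘ ρ) t
renT-as-subT ρ (var i) = refl
renT-as-subT ρ a       = refl
renT-as-subT ρ b       = refl
renT-as-subT ρ (s * t) = cong₂ _*_ (renT-as-subT ρ s) (renT-as-subT ρ t)
renT-as-subT ρ (S t)   = cong S (renT-as-subT ρ t)

subT-▸-wk : ∀ {m n} (σ : Sub m n) t u → subT (σ ▸ t) (wk u) ≡ subT σ u
subT-▸-wk σ t = subT-renT (σ ▸ t) suc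

extS-wk : ∀ {m n} (σ : Sub m n) t → subT (extS σ) (wk t) ≡ wk (subT σ t)
extS-wk σ t = trans (subT-renT (extS σ) suc t) (sym (renT-subT suc σ t))

extS-cong : ∀ {m n} {σ τ : Sub m n} → σ ≗ τ → extS σ ≗ extS τ
extS-cong e zero    = refl
extS-cong e (suc i) = cong wk (e i)

subF-cong : ∀ {m n} {σ τ : Sub m n} → σ ≗ τ → ∀ φ → subF σ φ ≡ subF τ φ
subF-cong e (s ≐ t) = cong₂ _≐_ (subT-cong e s) (subT-cong e t)
subF-cong e ⊥'      = refl
subF-cong e (φ ⇒ ψ) = cong₂ _⇒_ (subF-cong e φ) (subF-cong e ψ)
subF-cong e (φ ∧ ψ) = cong₂ _∧_ (subF-cong e φ) (subF-cong e ψ)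
subF-cong e (φ ∨ ψ) = cong₂ _∨_ (subF-cong e φ) (subF-cong e ψ)
subF-cong e (∀' φ)  = cong ∀' (subF-cong (extS-cong e) φ)
subF-cong e (∃' φ)  = cong ∃' (subF-cong (extS-cong e) φ)

subF-id : ∀ {n} (φ : Formula n) → subF var φ ≡ φ
subF-id (s ≐ t) = cong₂ _≐_ (subT-id s) (subT-id t)
subF-id ⊥'      = refl
subF-id (φ ⇒ ψ) = cong₂ _⇒_ (subF-id φ) (subF-id ψ)
subF-id (φ ∧ ψ) = cong₂ _∧_ (subF-id φ) (subF-id ψ)
subF-id (φ ∨ ψ) = cong₂ _∨_ (subF-id φ) (subF-id ψ)
subF-id (∀' φ)  = cong ∀' (trans (subF-cong extS-var φ) (subF-id φ))
  where
  extS-var : extS var ≗ var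
  extS-var zero    = refl
  extS-var (suc i) = refl
subF-id (∃' φ)  = cong ∃' (trans (subF-cong extS-var φ) (subF-id φ))
  where
  extS-var : extS var ≗ var
  extS-var zero    = refl
  extS-var (suc i) = refl

subF-subF : ∀ {l m n} (σ : Sub m n) (τ : Sub l m) φ →
            subF σ (subF τ φ) ≡ subF (subT σ ∘ τ) φ
subF-subF σ τ (s ≐ t) = cong₂ _≐_ (subT-subT σ τ s) (subT-subT σ τ t)
subF-subF σ τ ⊥'      = refl
subF-subF σ τ (φ ⇒ ψ) = cong₂ _⇒_ (subF-subF σ τ φ) (subF-subF σ τ ψ)
subF-subF σ τ (φ ∧ ψ) = cong₂ _∧_ (subF-subF σ τ φ) (subF-subF σ τ ψ)
subF-subF σ τ (φ ∨ ψ) = cong₂ _∨_ (subF-subF σ τ φ) (subF-subF σ τ ψ)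
subF-subF σ τ (∀' φ)  = cong ∀' (trans (subF-subF (extS σ) (extS τ) φ) (subF-cong (extS-∘ σ τ) φ))
  where
  extS-∘ : ∀ {l m n} (σ : Sub m n) (τ : Sub l m) → subT (extS σ) ∘ extS τ ≗ extS (subT σ ∘ τ)
  extS-∘ σ τ zero    = refl
  extS-∘ σ τ (suc i) = extS-wk σ (τ i)
subF-subF σ τ (∃' φ)  = cong ∃' (trans (subF-subF (extS σ) (extS τ) φ) (subF-cong (extS-∘ σ τ) φ))
  where
  extS-∘ : ∀ {l m n} (σ : Sub m n) (τ : Sub l m) → subT (extS σ) ∘ extS τ ≗ extS (subT σ ∘ τ)
  extS-∘ σ τ zero    = refl
  extS-∘ σ τ (suc i) = extS-wk σ (τ i)

renF-as-subF : ∀ {m n} (ρ : Ren m n) φ → renF ρ φ ≡ subF (var ∘ ρ) φ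
renF-as-subF ρ (s ≐ t) = cong₂ _≐_ (renT-as-subT ρ s) (renT-as-subT ρ t)
renF-as-subF ρ ⊥'      = refl
renF-as-subF ρ (φ ⇒ ψ) = cong₂ _⇒_ (renF-as-subF ρ φ) (renF-as-subF ρ ψ)
renF-as-subF ρ (φ ∧ ψ) = cong₂ _∧_ (renF-as-subF ρ φ) (renF-as-subF ρ ψ)
renF-as-subF ρ (φ ∨ ψ) = cong₂ _∨_ (renF-as-subF ρ φ) (renF-as-subF ρ ψ)
renF-as-subF ρ (∀' φ)  = cong ∀' (trans (renF-as-subF (extR ρ) φ) (subF-cong (extR-var ρ) φ))
  where
  extR-var : ∀ {m n} (ρ : Ren m n) → var ∘ extR ρ ≗ extS (var ∘ ρ)
  extR-var ρ zero    = refl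
  extR-var ρ (suc i) = refl
renF-as-subF ρ (∃' φ)  = cong ∃' (trans (renF-as-subF (extR ρ) φ) (subF-cong (extR-var ρ) φ))
  where
  extR-var : ∀ {m n} (ρ : Ren m n) → var ∘ extR ρ ≗ extS (var ∘ ρ)
  extR-var ρ zero    = refl
  extR-var ρ (suc i) = refl

subF-fuse : ∀ {l m n} {σ : Sub m n} {τ : Sub l m} {υ : Sub l n} →
            subT σ ∘ τ ≗ υ → ∀ φ → subF σ (subF τ φ) ≡ subF υ φ
subF-fuse {σ = σ} {τ} e φ = trans (subF-subF σ τ φ) (subF-cong e φ)

subF-wkF : ∀ {m n} (σ : Sub m n) φ → subF (extS σ) (wkF φ) ≡ wkF (subF σ φ)
subF-wkF σ φ = begin
  subF (extS σ) (wkF φ)            ≡⟨ cong (subF (extS σ)) (renF-as-subF suc φ) ⟩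
  subF (extS σ) (subF (var ∘ suc) φ) ≡⟨ subF-fuse (λ i → renT-as-subT suc (σ i)) φ ⟩
  subF (subT (var ∘ suc) ∘ σ) φ     ≡⟨ sym (subF-subF (var ∘ suc) σ φ) ⟩
  subF (var ∘ suc) (subF σ φ)      ≡⟨ sym (renF-as-subF suc (subF σ φ)) ⟩
  wkF (subF σ φ)                   ∎
  where open ≡-Reasoning

[]-as-subF : ∀ {n} (φ : Formula (suc n)) t → φ [ t ] ≡ subF (var ▸ t) φ
[]-as-subF φ t = subF-cong pointwise φ
  where
  pointwise : ∀ i → _ ≡ (var ▸ t) i
  pointwise zero    = refl
  pointwise (suc i) = refl

subF-[] : ∀ {m n} (σ : Sub m n) φ t → subF σ (φ [ t ]) ≡ subF (extS σ) φ [ subT σ t ]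
subF-[] σ φ t = begin
  subF σ (φ [ t ])                         ≡⟨ cong (subF σ) ([]-as-subF φ t) ⟩
  subF σ (subF (var ▸ t) φ)                ≡⟨ subF-fuse left φ ⟩
  subF (σ ▸ subT σ t) φ                    ≡⟨ sym (subF-fuse right φ) ⟩
  subF (var ▸ subT σ t) (subF (extS σ) φ)  ≡⟨ sym ([]-as-subF (subF (extS σ) φ) (subT σ t)) ⟩
  subF (extS σ) φ [ subT σ t ]             ∎
  where
  open ≡-Reasoning
  left : subT σ ∘ (var ▸ t) ≗ σ ▸ subT σ t
  left zero    = refl
  left (suc i) = refl
  right : subT (var ▸ subT σ t) ∘ extS σ ≗ σ ▸ subT σ t
  right zero    = refl
  right (suc i) = trans (subT-▸-wk var (subT σ t) (σ i)) (subT-id (σ i))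

subF-embed : ∀ {m n} (σ : Sub m n) (φ : Formula 0) → subF σ (embed φ) ≡ embed φ
subF-embed σ φ =
  trans (cong (subF σ) (renF-as-subF _ φ)) (trans (subF-fuse (λ ()) φ) (sym (renF-as-subF _ φ)))

map-subF-wkF : ∀ {m n} (σ : Sub m n) Γ → map (subF (extS σ)) (map wkF Γ) ≡ map wkF (map (subF σ) Γ)
map-subF-wkF σ []      = refl
map-subF-wkF σ (φ ∷ Γ) = cong₂ _∷_ (subF-wkF σ φ) (map-subF-wkF σ Γ)

weaken : ∀ {n} {Γ Δ : List (Formula n)} {φ} → Γ ⊆ₗ Δ → Γ ⊢ φ → Δ ⊢ φ
weaken s (hyp p)          = hyp (s p)
weaken s (ax x)           = ax x
weaken s (⇒I d)           = ⇒I (weaken (∷⁺ʳ _ s) d)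
weaken s (⇒E d e)         = ⇒E (weaken s d) (weaken s e)
weaken s (∧I d e)         = ∧I (weaken s d) (weaken s e)
weaken s (∧E₁ d)          = ∧E₁ (weaken s d)
weaken s (∧E₂ d)          = ∧E₂ (weaken s d)
weaken s (∨I₁ d)          = ∨I₁ (weaken s d)
weaken s (∨I₂ d)          = ∨I₂ (weaken s d)
weaken s (∨E d e f)       = ∨E (weaken s d) (weaken (∷⁺ʳ _ s) e) (weaken (∷⁺ʳ _ s) f)
weaken s (raa d)          = raa (weaken (∷⁺ʳ _ s) d)
weaken s (∀I d)           = ∀I (weaken (map⁺ wkF s) d)
weaken s (∀E d t)         = ∀E (weaken s d) t
weaken s (∃I t d)         = ∃I t (weaken s d)
weaken s (∃E d e)         = ∃E (weaken s d) (weaken (∷⁺ʳ _ (map⁺ wkF s)) e)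
weaken s ≐refl            = ≐refl
weaken s (≐subst φ d e)   = ≐subst φ (weaken s d) (weaken s e)

substitute : ∀ {m n} (σ : Sub m n) {Γ : List (Formula m)} {φ} → Γ ⊢ φ → map (subF σ) Γ ⊢ subF σ φ
substitute σ (hyp p)               = hyp (∈-map⁺ (subF σ) p)
substitute σ (ax {φ = φ} x)        = subst (_ ⊢_) (sym (subF-embed σ φ)) (ax x)
substitute σ (⇒I d)                = ⇒I (substitute σ d)
substitute σ (⇒E d e)              = ⇒E (substitute σ d) (substitute σ e)
substitute σ (∧I d e)              = ∧I (substitute σ d) (substitute σ e)
substitute σ (∧E₁ d)               = ∧E₁ (substitute σ d)
substitute σ (∧E₂ d)               = ∧E₂ (substitute σ d)
substitute σ (∨I₁ d)               = ∨I₁ (substitute σ d)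
substitute σ (∨I₂ d)               = ∨I₂ (substitute σ d)
substitute σ (∨E d e f)            = ∨E (substitute σ d) (substitute σ e) (substitute σ f)
substitute σ (raa d)               = raa (substitute σ d)
substitute σ {Γ} (∀I d)            =
  ∀I (subst (_⊢ _) (map-subF-wkF σ Γ) (substitute (extS σ) d))
substitute σ (∀E {φ = φ} d t)      =
  subst (_ ⊢_) (sym (subF-[] σ φ t)) (∀E (substitute σ d) (subT σ t))
substitute σ (∃I {φ = φ} t d)      =
  ∃I (subT σ t) (subst (_ ⊢_) (subF-[] σ φ t) (substitute σ d))
substitute σ {Γ} (∃E {ψ = ψ} d e)  =
  ∃E (substitute σ d)
     (subst₂ (λ Δ χ → (_ ∷ Δ) ⊢ χ) (map-subF-wkF σ Γ) (subF-wkF σ ψ) (substitute (extS σ) e))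
substitute σ ≐refl                 = ≐refl
substitute σ (≐subst {s = s} {t} φ d e) =
  subst (_ ⊢_) (sym (subF-[] σ φ t))
    (≐subst (subF (extS σ) φ) (substitute σ d) (subst (_ ⊢_) (subF-[] σ φ s) (substitute σ e)))

∀* : ∀ m → Formula m → Formula 0
∀* zero    φ = φ
∀* (suc m) φ = ∀* m (∀' φ)

instantiate : ∀ {m n} {Γ : List (Formula n)} {φ : Formula m} → QT⁺⊢ ∀* m φ → (σ : Sub m n) → Γ ⊢ subF σ φ
instantiate {zero} {φ = φ} d σ = weaken (λ ()) (subst ([] ⊢_) (subF-cong (λ ()) φ) (substitute ∅ₛ d))
instantiate {suc m} {φ = φ} d σ =
  subst (_ ⊢_) (trans ([]-as-subF _ (σ zero)) (subF-fuse pointwise φ)) (∀E (instantiate d (σ ∘ suc)) (σ zero))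
  where
  pointwise : subT (var ▸ σ zero) ∘ extS (σ ∘ suc) ≗ σ
  pointwise zero    = refl
  pointwise (suc i) = trans (subT-▸-wk var (σ zero) (σ (suc i))) (subT-id (σ (suc i)))

module _ {n : ℕ} {Γ : List (Formula n)} where
  app-⇒ : ∀ {φ ψ : Formula 1} {t} → QT⁺⊢ ∀' (φ ⇒ ψ) → Γ ⊢ app φ t → Γ ⊢ app ψ t
  app-⇒ {φ} {ψ} {t} d = ⇒E (subst (Γ ⊢_) (cong₂ _⇒_ (at φ) (at ψ)) (instantiate d (∅ₛ ▸ t)))
    where
    only-t : ∅ₛ ▸ t ≗ λ _ → t
    only-t zero = refl
    at : ∀ χ → subF (∅ₛ ▸ t) χ ≡ app χ t
    at = subF-cong only-t

∀-open : ∀ {Γ : List (Formula 1)} {φ} → QT⁺⊢ ∀' φ → Γ ⊢ φ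
∀-open {φ = φ} d = subst (_ ⊢_) (trans (subF-cong only-v0 φ) (subF-id φ)) (instantiate d (∅ₛ ▸ var zero))
  where
  only-v0 : ∅ₛ ▸ var zero ≗ var
  only-v0 zero = refl

v0 : ∀ {n} → Term (suc n)
v0 = var zero
v1 : ∀ {n} → Term (suc (suc n))
v1 = var (suc zero)
v2 : ∀ {n} → Term (suc (suc (suc n)))
v2 = var (suc (suc zero))
v3 : ∀ {n} → Term (suc (suc (suc (suc n))))
v3 = var (suc (suc (suc zero)))
v4 : ∀ {n} → Term (suc (suc (suc (suc (suc n)))))
v4 = var (suc (suc (suc (suc zero))))
v5 : ∀ {n} → Term (suc (suc (suc (suc (suc (suc n))))))
v5 = var (suc (suc (suc (suc (suc zero)))))

module _ {n : ℕ} {Γ : List (Formula n)} where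
  h0 : ∀ {φ} → (φ ∷ Γ) ⊢ φ
  h0 = hyp (here refl)
  h1 : ∀ {φ ψ} → (ψ ∷ φ ∷ Γ) ⊢ φ
  h1 = hyp (there (here refl))
  h2 : ∀ {φ ψ χ} → (χ ∷ ψ ∷ φ ∷ Γ) ⊢ φ
  h2 = hyp (there (there (here refl)))
  h3 : ∀ {φ ψ χ ω} → (ω ∷ χ ∷ ψ ∷ φ ∷ Γ) ⊢ φ
  h3 = hyp (there (there (there (here refl))))
  h4 : ∀ {φ ψ χ ω α} → (α ∷ ω ∷ χ ∷ ψ ∷ φ ∷ Γ) ⊢ φ
  h4 = hyp (there (there (there (there (here refl)))))
  h5 : ∀ {φ ψ χ ω α β} → (β ∷ α ∷ ω ∷ χ ∷ ψ ∷ φ ∷ Γ) ⊢ φ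
  h5 = hyp (there (there (there (there (there (here refl))))))

  weaken₁ : ∀ {φ ψ} → Γ ⊢ φ → (ψ ∷ Γ) ⊢ φ
  weaken₁ = weaken there

  ⊥'-elim : ∀ {φ} → Γ ⊢ ⊥' → Γ ⊢ φ
  ⊥'-elim d = raa (weaken₁ d)

  ¬'-elim : ∀ {φ ψ} → Γ ⊢ ¬' φ → Γ ⊢ φ → Γ ⊢ ψ
  ¬'-elim d e = ⊥'-elim (⇒E d e)

  cut : ∀ {φ ψ} → Γ ⊢ φ → (φ ∷ Γ) ⊢ ψ → Γ ⊢ ψ
  cut d e = ⇒E (⇒I e) d

  cases : ∀ {φ ψ χ} → Γ ⊢ φ ∨ ψ → Γ ⊢ φ ⇒ χ → Γ ⊢ ψ ⇒ χ → Γ ⊢ χ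
  cases d e f = ∨E d (⇒E (weaken₁ e) h0) (⇒E (weaken₁ f) h0)

-- A lemma named ⊢… is a sentence proved over de Bruijn variables, where weakening and
-- substitution of its formulas compute; instantiate then applies it to arbitrary terms.
⊢≐-sym : QT⁺⊢ ∀' (∀' (v1 ≐ v0 ⇒ v0 ≐ v1))
⊢≐-sym = ∀I (∀I (⇒I (≐subst (v0 ≐ v2) h0 ≐refl)))

⊢≐-trans : QT⁺⊢ ∀' (∀' (∀' (v2 ≐ v1 ⇒ v1 ≐ v0 ⇒ v2 ≐ v0)))
⊢≐-trans = ∀I (∀I (∀I (⇒I (⇒I (≐subst (v3 ≐ v0) h0 h1)))))

⊢*-cong : QT⁺⊢ ∀' (∀' (∀' (∀' (v3 ≐ v2 ⇒ v1 ≐ v0 ⇒ v3 * v1 ≐ v2 * v0))))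
⊢*-cong = ∀I (∀I (∀I (∀I (⇒I (⇒I (≐subst (v4 * v2 ≐ v3 * v0) h0 (≐subst (v4 * v2 ≐ v0 * v2) h1 ≐refl)))))))

module _ {n : ℕ} {Γ : List (Formula n)} where
  infixr 4 _⟫_

  ≐-sym : ∀ {s t} → Γ ⊢ s ≐ t → Γ ⊢ t ≐ s
  ≐-sym {s} {t} = ⇒E (instantiate ⊢≐-sym (∅ₛ ▸ s ▸ t))

  _⟫_ : ∀ {s t u} → Γ ⊢ s ≐ t → Γ ⊢ t ≐ u → Γ ⊢ s ≐ u
  _⟫_ {s} {t} {u} d e = ⇒E (⇒E (instantiate ⊢≐-trans (∅ₛ ▸ s ▸ t ▸ u)) d) e

  *-cong : ∀ {s t u w} → Γ ⊢ s ≐ t → Γ ⊢ u ≐ w → Γ ⊢ s * u ≐ t * w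
  *-cong {s} {t} {u} {w} d e = ⇒E (⇒E (instantiate ⊢*-cong (∅ₛ ▸ s ▸ t ▸ u ▸ w)) d) e

  *-congˡ : ∀ {s t u} → Γ ⊢ s ≐ t → Γ ⊢ u * s ≐ u * t
  *-congˡ = *-cong ≐refl

  *-congʳ : ∀ {s t u} → Γ ⊢ s ≐ t → Γ ⊢ s * u ≐ t * u
  *-congʳ d = *-cong d ≐refl

  *-assoc : ∀ s t u → Γ ⊢ (s * t) * u ≐ s * (t * u)
  *-assoc s t u = ≐-sym (instantiate (ax QT1) (∅ₛ ▸ s ▸ t ▸ u))

  *-assoc⁻¹ : ∀ s t u → Γ ⊢ s * (t * u) ≐ (s * t) * u
  *-assoc⁻¹ s t u = instantiate (ax QT1) (∅ₛ ▸ s ▸ t ▸ u)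

  *≐a-elim : ∀ {s t φ} → Γ ⊢ s * t ≐ a → Γ ⊢ φ
  *≐a-elim {s} {t} = ¬'-elim (∧E₁ (instantiate (ax QT2) (∅ₛ ▸ s ▸ t)))

  *≐b-elim : ∀ {s t φ} → Γ ⊢ s * t ≐ b → Γ ⊢ φ
  *≐b-elim {s} {t} = ¬'-elim (∧E₂ (instantiate (ax QT2) (∅ₛ ▸ s ▸ t)))

  *a-cancelʳ : ∀ {s t} → Γ ⊢ s * a ≐ t * a → Γ ⊢ s ≐ t
  *a-cancelʳ {s} {t} = ⇒E (∧E₁ (instantiate (ax QT3) (∅ₛ ▸ s ▸ t)))

  *b-cancelʳ : ∀ {s t} → Γ ⊢ s * b ≐ t * b → Γ ⊢ s ≐ t
  *b-cancelʳ {s} {t} = ⇒E (∧E₁ (∧E₂ (instantiate (ax QT3) (∅ₛ ▸ s ▸ t))))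

  a*-cancelˡ : ∀ {s t} → Γ ⊢ a * s ≐ a * t → Γ ⊢ s ≐ t
  a*-cancelˡ {s} {t} = ⇒E (∧E₁ (∧E₂ (∧E₂ (instantiate (ax QT3) (∅ₛ ▸ s ▸ t)))))

  b*-cancelˡ : ∀ {s t} → Γ ⊢ b * s ≐ b * t → Γ ⊢ s ≐ t
  b*-cancelˡ {s} {t} = ⇒E (∧E₂ (∧E₂ (∧E₂ (instantiate (ax QT3) (∅ₛ ▸ s ▸ t)))))

  a*≐b*-elim : ∀ {s t φ} → Γ ⊢ a * s ≐ b * t → Γ ⊢ φ
  a*≐b*-elim {s} {t} = ¬'-elim (∧E₁ (instantiate (ax QT4) (∅ₛ ▸ s ▸ t)))

  *a≐*b-elim : ∀ {s t φ} → Γ ⊢ s * a ≐ t * b → Γ ⊢ φ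
  *a≐*b-elim {s} {t} = ¬'-elim (∧E₂ (instantiate (ax QT4) (∅ₛ ▸ s ▸ t)))

  a-or-b-or-compound : ∀ t → Γ ⊢ (t ≐ a ∨ t ≐ b ∨
                                  (∃' (a * v0 ≐ wk t ∨ b * v0 ≐ wk t)
                                   ∧ ∃' (v0 * a ≐ wk t ∨ v0 * b ≐ wk t)))
  a-or-b-or-compound t = instantiate (ax QT5) (∅ₛ ▸ t)

  S≐*b : ∀ {t} → Γ ⊢ ¬' (t ≐ a) → Γ ⊢ S t ≐ t * b
  S≐*b {t} d = ⇒E (∧E₂ (instantiate (ax QT6) (∅ₛ ▸ t ▸ t * b))) (∨I₂ (∧I d ≐refl))

  a≐b-elim : ∀ {φ} → Γ ⊢ a ≐ b → Γ ⊢ φ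
  a≐b-elim d = a*≐b*-elim (*-congʳ {u = a} d)

  app-subst : ∀ (φ : Formula 1) {s t} → Γ ⊢ s ≐ t → Γ ⊢ app φ s → Γ ⊢ app φ t
  app-subst φ {s} {t} d e = subst (_ ⊢_) (app-[] t) (≐subst (app φ v0) d (subst (_ ⊢_) (sym (app-[] s)) e))
    where
    app-[] : ∀ u → app φ v0 [ u ] ≡ app φ u
    app-[] u = trans ([]-as-subF (app φ v0) u) (subF-fuse (λ _ → refl) φ)

  use : ∀ {φ} → QT⁺⊢ φ → Γ ⊢ subF ∅ₛ φ
  use d = instantiate d ∅ₛ

⊆p-*ʳ : ∀ {Γ : List (Formula 3)} → Γ ⊢ v0 ⊆p v2 → Γ ⊢ v0 ⊆p (v2 * v1)
⊆p-*ʳ d = ∨E d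
  (∨I₂ (∨I₁ (∃I v1 (*-congʳ h0))))
  (∨E h0
     (∃E h0 (∨I₂ (∨I₁ (∃I (v0 * v2) (*-assoc⁻¹ v1 v0 v2 ⟫ *-congʳ h0)))))
     (∨E h0
        (∃E h0 (∨I₂ (∨I₂ (∨I₂ (∃I v0 (∃I v2 (*-congʳ (≐-sym h0) ⟫ *-assoc v0 v1 v2)))))))
        (∃E h0 (∃E h0 (∨I₂ (∨I₂ (∨I₂ (∃I v1 (∃I (v0 * v3)
            (*-congʳ h0 ⟫ *-assoc v1 (v2 * v0) v3 ⟫ *-congˡ (*-assoc v2 v0 v3)))))))))))

⊆p-*ˡ : ∀ {Γ : List (Formula 3)} → Γ ⊢ v0 ⊆p v1 → Γ ⊢ v0 ⊆p (v2 * v1)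
⊆p-*ˡ d = ∨E d
  (∨I₂ (∨I₂ (∨I₁ (∃I v2 (*-congˡ h0)))))
  (∨E h0
     (∃E h0 (∨I₂ (∨I₂ (∨I₂ (∃I v3 (∃I v0 (*-congˡ (≐-sym h0))))))))
     (∨E h0
        (∃E h0 (∨I₂ (∨I₂ (∨I₁ (∃I (v3 * v0) (*-assoc v3 v0 v1 ⟫ *-congˡ h0))))))
        (∃E h0 (∃E h0 (∨I₂ (∨I₂ (∨I₂ (∃I (v4 * v1) (∃I v0
            (*-congˡ h0 ⟫ *-assoc⁻¹ v4 v1 (v2 * v0)))))))))))

⊢tally-*ʳ : QT⁺⊢ ∀' (∀' (Tallyb (v1 * v0) ⇒ Tallyb v1))
⊢tally-*ʳ = ∀I (∀I (⇒I (∀I (⇒I (⇒E (∀E h1 v0) (∧I (⊆p-*ʳ (∧E₁ h0)) (∧E₂ h0)))))))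

⊢tally-*ˡ : QT⁺⊢ ∀' (∀' (Tallyb (v1 * v0) ⇒ Tallyb v0))
⊢tally-*ˡ = ∀I (∀I (⇒I (∀I (⇒I (⇒E (∀E h1 v0) (∧I (⊆p-*ˡ (∧E₁ h0)) (∧E₂ h0)))))))

⊢tally-excludes-a : QT⁺⊢ ∀' (∀' (Tallyb v1 ⇒ v0 ⊆p v1 ⇒ ¬' (v0 ≐ a)))
⊢tally-excludes-a = ∀I (∀I (⇒I (⇒I (⇒I (a≐b-elim (≐-sym h0 ⟫ ⇒E (∀E h2 v0) (∧I h1 (∨I₁ h0))))))))

module _ {n : ℕ} {Γ : List (Formula n)} where
  tally-*ʳ : ∀ {p w} → Γ ⊢ Tallyb (p * w) → Γ ⊢ Tallyb p
  tally-*ʳ {p} {w} = ⇒E (instantiate ⊢tally-*ʳ (∅ₛ ▸ p ▸ w))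

  tally-*ˡ : ∀ {p w} → Γ ⊢ Tallyb (p * w) → Γ ⊢ Tallyb w
  tally-*ˡ {p} {w} = ⇒E (instantiate ⊢tally-*ˡ (∅ₛ ▸ p ▸ w))

  tally-excludes-a : ∀ {x y φ} → Γ ⊢ Tallyb x → Γ ⊢ y ⊆p x → Γ ⊢ y ≐ a → Γ ⊢ φ
  tally-excludes-a {x} {y} d e = ¬'-elim (⇒E (⇒E (instantiate ⊢tally-excludes-a (∅ₛ ▸ x ▸ y)) d) e)

⊢tally-B : QT⁺⊢ ∀' (∀' (v1 B v0 ⇒ Tallyb v0 ⇒ Tallyb v1))
⊢tally-B = ∀I (∀I (⇒I (⇒I (∃E h1 (tally-*ʳ (app-subst (Tallyb v0) (≐-sym h0) h1))))))

module _ {n : ℕ} {Γ : List (Formula n)} where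
  tally-B : ∀ {p x} → Γ ⊢ p B x → Γ ⊢ Tallyb x → Γ ⊢ Tallyb p
  tally-B {p} {x} d = ⇒E (⇒E (instantiate ⊢tally-B (∅ₛ ▸ p ▸ x)) d)

  tally-≢a : ∀ {x} → Γ ⊢ Tallyb x → Γ ⊢ ¬' (x ≐ a)
  tally-≢a d = ⇒I (tally-excludes-a (weaken₁ d) (∨I₁ ≐refl) h0)

CommutesWithB : ∀ {n} → Term n → Formula n
CommutesWithB u = b * u ≐ u * b

InBicommutantOfB : ∀ {n} → Term n → Formula n
InBicommutantOfB y = ∀' (CommutesWithB v0 ⇒ v0 * wk y ≐ wk y * v0)

LeftCancellable : ∀ {n} → Term n → Formula n
LeftCancellable x = ∀' (∀' (wk (wk x) * v1 ≐ wk (wk x) * v0 ⇒ v1 ≐ v0))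

Tame : ∀ {n} → Term n → Formula n
Tame p = LeftCancellable p ∧ (Tallyb p ⇒ CommutesWithB p)

infix 6 _⊑_

_⊑_ : ∀ {n} → Term n → Term n → Formula n
p ⊑ x = p ≐ x ∨ p B x

Good : ∀ {n} → Term n → Formula n
Good x = ∀' (v0 ⊑ wk x ⇒ Tame v0) ∧ (Tallyb x ⇒ InBicommutantOfB x)

⊢left-cancel : QT⁺⊢ ∀' (∀' (∀' (LeftCancellable v2 ⇒ v2 * v1 ≐ v2 * v0 ⇒ v1 ≐ v0)))
⊢left-cancel = ∀I (∀I (∀I (⇒I (⇒I (⇒E (∀E (∀E h1 v1) v0) h0)))))

⊢bicommutant-elim : QT⁺⊢ ∀' (∀' (InBicommutantOfB v1 ⇒ CommutesWithB v0 ⇒ v0 * v1 ≐ v1 * v0))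
⊢bicommutant-elim = ∀I (∀I (⇒I (⇒I (⇒E (∀E h1 v0) h0))))

⊢good-tame : QT⁺⊢ ∀' (∀' (Good v1 ⇒ v0 ⊑ v1 ⇒ Tame v0))
⊢good-tame = ∀I (∀I (⇒I (⇒I (⇒E (∀E (∧E₁ h1) v0) h0))))

module _ {n : ℕ} {Γ : List (Formula n)} where
  left-cancel : ∀ {x u w} → Γ ⊢ LeftCancellable x → Γ ⊢ x * u ≐ x * w → Γ ⊢ u ≐ w
  left-cancel {x} {u} {w} d = ⇒E (⇒E (instantiate ⊢left-cancel (∅ₛ ▸ x ▸ u ▸ w)) d)

  bicommutant-elim : ∀ {y u} → Γ ⊢ InBicommutantOfB y → Γ ⊢ CommutesWithB u → Γ ⊢ u * y ≐ y * u
  bicommutant-elim {y} {u} d = ⇒E (⇒E (instantiate ⊢bicommutant-elim (∅ₛ ▸ y ▸ u)) d)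

  good-tame : ∀ {x p} → Γ ⊢ Good x → Γ ⊢ p ⊑ x → Γ ⊢ Tame p
  good-tame {x} {p} d = ⇒E (⇒E (instantiate ⊢good-tame (∅ₛ ▸ x ▸ p)) d)

  good-tally-commutesWithB : ∀ {x} → Γ ⊢ Good x → Γ ⊢ Tallyb x → Γ ⊢ CommutesWithB x
  good-tally-commutesWithB d = ⇒E (∧E₂ (good-tame d (∨I₁ ≐refl)))

⊢leftCancellable-a : QT⁺⊢ LeftCancellable a
⊢leftCancellable-a = ∀I (∀I (⇒I (a*-cancelˡ h0)))

⊢leftCancellable-b : QT⁺⊢ LeftCancellable b
⊢leftCancellable-b = ∀I (∀I (⇒I (b*-cancelˡ h0)))

⊢leftCancellable-* : QT⁺⊢ ∀' (∀' (LeftCancellable v1 ⇒ LeftCancellable v0 ⇒ LeftCancellable (v1 * v0)))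
⊢leftCancellable-* = ∀I (∀I (⇒I (⇒I (∀I (∀I (⇒I
  (left-cancel h1 (left-cancel h2 (*-assoc⁻¹ v3 v2 v1 ⟫ h0 ⟫ *-assoc v3 v2 v0)))))))))

⊢bicommutant-* : QT⁺⊢ ∀' (∀' (InBicommutantOfB v1 ⇒ InBicommutantOfB v0 ⇒ InBicommutantOfB (v1 * v0)))
⊢bicommutant-* = ∀I (∀I (⇒I (⇒I (∀I (⇒I
  (*-assoc⁻¹ v0 v2 v1 ⟫ *-congʳ (bicommutant-elim h2 h0) ⟫ *-assoc v2 v0 v1
   ⟫ *-congˡ (bicommutant-elim h1 h0) ⟫ *-assoc⁻¹ v2 v1 v0))))))

module _ {n : ℕ} {Γ : List (Formula n)} where
  tally-commutesWithB-* : ∀ {x y} →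
    Γ ⊢ Tallyb x ⇒ CommutesWithB x → Γ ⊢ Tallyb y ⇒ CommutesWithB y →
    Γ ⊢ Tallyb (x * y) ⇒ CommutesWithB (x * y)
  tally-commutesWithB-* {x} {y} d e = ⇒I
    (*-assoc⁻¹ b x y ⟫ *-congʳ (⇒E (weaken₁ d) (tally-*ʳ h0)) ⟫ *-assoc x b y
     ⟫ *-congˡ (⇒E (weaken₁ e) (tally-*ˡ h0)) ⟫ *-assoc⁻¹ x y b)

  tally-bicommutant-* : ∀ {x y} →
    Γ ⊢ Tallyb x ⇒ InBicommutantOfB x → Γ ⊢ Tallyb y ⇒ InBicommutantOfB y →
    Γ ⊢ Tallyb (x * y) ⇒ InBicommutantOfB (x * y)
  tally-bicommutant-* {x} {y} d e = ⇒I
    (⇒E (⇒E (instantiate ⊢bicommutant-* (∅ₛ ▸ x ▸ y))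
            (⇒E (weaken₁ d) (tally-*ʳ h0)))
        (⇒E (weaken₁ e) (tally-*ˡ h0)))

  tame-* : ∀ {x y} → Γ ⊢ Tame x → Γ ⊢ Tame y → Γ ⊢ Tame (x * y)
  tame-* {x} {y} d e =
    ∧I (⇒E (⇒E (instantiate ⊢leftCancellable-* (∅ₛ ▸ x ▸ y)) (∧E₁ d)) (∧E₁ e))
       (tally-commutesWithB-* (∧E₂ d) (∧E₂ e))

⊢tame-a : QT⁺⊢ Tame a
⊢tame-a = ∧I ⊢leftCancellable-a (⇒I (¬'-elim (tally-≢a h0) ≐refl))

⊢tame-b : QT⁺⊢ Tame b
⊢tame-b = ∧I ⊢leftCancellable-b (⇒I ≐refl)

⊢tally-bicommutant-a : QT⁺⊢ (Tallyb a ⇒ InBicommutantOfB a)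
⊢tally-bicommutant-a = ⇒I (¬'-elim (tally-≢a h0) ≐refl)

⊢tally-bicommutant-b : QT⁺⊢ (Tallyb b ⇒ InBicommutantOfB b)
⊢tally-bicommutant-b = ⇒I (∀I (⇒I (≐-sym h0)))

⊢prefix-*a : QT⁺⊢ ∀' (∀' (v0 B (v1 * a) ⇒ v0 ⊑ v1))
⊢prefix-*a = ∀I (∀I (⇒I (∃E h0 (∨E (a-or-b-or-compound v0)
  (∨I₁ (*a-cancelʳ (*-congˡ (≐-sym h0) ⟫ h1)))
  (∨E h0 (*a≐*b-elim (≐-sym h2 ⟫ *-congˡ h0))
     (∃E (∧E₂ h0) (∨E h0
        (∨I₂ (∃I v0 (*a-cancelʳ (*-assoc v2 v0 a ⟫ *-congˡ h0 ⟫ h4))))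
        (*a≐*b-elim (≐-sym h4 ⟫ *-congˡ (≐-sym h0) ⟫ *-assoc⁻¹ v2 v0 b)))))))))

⊢prefix-*b : QT⁺⊢ ∀' (∀' (v0 B (v1 * b) ⇒ v0 ⊑ v1))
⊢prefix-*b = ∀I (∀I (⇒I (∃E h0 (∨E (a-or-b-or-compound v0)
  (*a≐*b-elim (*-congˡ (≐-sym h0) ⟫ h1))
  (∨E h0 (∨I₁ (*b-cancelʳ (*-congˡ (≐-sym h0) ⟫ h2)))
     (∃E (∧E₂ h0) (∨E h0
        (*a≐*b-elim (*-assoc v2 v0 a ⟫ *-congˡ h0 ⟫ h4))
        (∨I₂ (∃I v0 (*b-cancelʳ (*-assoc v2 v0 b ⟫ *-congˡ h0 ⟫ h4)))))))))))

⊢good-a : QT⁺⊢ Good a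
⊢good-a = ∧I (∀I (⇒I (∨E h0 (app-subst (Tame v0) (≐-sym h0) (use ⊢tame-a)) (∃E h0 (*≐a-elim h0)))))
             ⊢tally-bicommutant-a

⊢good-b : QT⁺⊢ Good b
⊢good-b = ∧I (∀I (⇒I (∨E h0 (app-subst (Tame v0) (≐-sym h0) (use ⊢tame-b)) (∃E h0 (*≐b-elim h0)))))
             ⊢tally-bicommutant-b

⊢good-*a : QT⁺⊢ ∀' (Good v0 ⇒ Good (v0 * a))
⊢good-*a = ∀I (⇒I (∧I
  (∀I (⇒I (∨E h0
     (app-subst (Tame v0) (≐-sym h0) (tame-* (good-tame h2 (∨I₁ ≐refl)) (use ⊢tame-a)))
     (good-tame h2 (⇒E (instantiate ⊢prefix-*a (∅ₛ ▸ v1 ▸ v0)) h0)))))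
  (tally-bicommutant-* (∧E₂ h0) (use ⊢tally-bicommutant-a))))

⊢good-*b : QT⁺⊢ ∀' (Good v0 ⇒ Good (v0 * b))
⊢good-*b = ∀I (⇒I (∧I
  (∀I (⇒I (∨E h0
     (app-subst (Tame v0) (≐-sym h0) (tame-* (good-tame h2 (∨I₁ ≐refl)) (use ⊢tame-b)))
     (good-tame h2 (⇒E (instantiate ⊢prefix-*b (∅ₛ ▸ v1 ▸ v0)) h0)))))
  (tally-bicommutant-* (∧E₂ h0) (use ⊢tally-bicommutant-b))))

⊢B-respˡ : QT⁺⊢ ∀' (∀' (∀' (v2 ≐ v1 ⇒ v1 B v0 ⇒ v2 B v0)))
⊢B-respˡ = ∀I (∀I (∀I (⇒I (⇒I (∃E h0 (∃I v0 (*-congʳ h2 ⟫ h0)))))))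

module _ {n : ℕ} {Γ : List (Formula n)} where
  B-respˡ : ∀ {s t u} → Γ ⊢ s ≐ t → Γ ⊢ t B u → Γ ⊢ s B u
  B-respˡ {s} {t} {u} d = ⇒E (⇒E (instantiate ⊢B-respˡ (∅ₛ ▸ s ▸ t ▸ u)) d)

  cofactor-commutesWithB : ∀ {x w y} → Γ ⊢ x * w ≐ y → Γ ⊢ LeftCancellable x →
                           Γ ⊢ CommutesWithB x → Γ ⊢ CommutesWithB y → Γ ⊢ CommutesWithB w
  cofactor-commutesWithB {x} {w} {y} xw≐y lc cx cy = left-cancel lc
    (*-assoc⁻¹ x b w ⟫ *-congʳ (≐-sym cx) ⟫ *-assoc b x w ⟫ *-congˡ xw≐y
     ⟫ cy ⟫ *-congʳ (≐-sym xw≐y) ⟫ *-assoc x w b)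

  cancel-common-prefix : ∀ {x₁ w y₁ x₂ y₂} → Γ ⊢ x₁ * w ≐ y₁ → Γ ⊢ LeftCancellable x₁ →
    Γ ⊢ CommutesWithB x₁ → Γ ⊢ CommutesWithB y₁ → Γ ⊢ InBicommutantOfB y₂ →
    Γ ⊢ x₁ * x₂ ≐ y₁ * (y₂ * b) → Γ ⊢ x₂ ≐ (y₂ * b) * w
  cancel-common-prefix {x₁} {w} {y₁} {x₂} {y₂} x₁w≐y₁ lc cx₁ cy₁ bic eq =
    left-cancel lc (eq ⟫ *-congʳ (≐-sym x₁w≐y₁) ⟫ *-assoc x₁ w (y₂ * b))
    ⟫ *-assoc⁻¹ w y₂ b ⟫ *-congʳ (bicommutant-elim bic cw) ⟫ *-assoc y₂ w b
    ⟫ *-congˡ (≐-sym cw) ⟫ *-assoc⁻¹ y₂ b w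
    where
    cw : Γ ⊢ CommutesWithB w
    cw = cofactor-commutesWithB x₁w≐y₁ lc cx₁ cy₁

⊢cancel-common-prefix : QT⁺⊢ ∀' (∀' (∀' (∀' (v3 B v2 ⇒ LeftCancellable v3 ⇒ CommutesWithB v3
                          ⇒ CommutesWithB v2 ⇒ InBicommutantOfB v0 ⇒ v3 * v1 ≐ v2 * (v0 * b)
                          ⇒ (v0 * b) B v1))))
⊢cancel-common-prefix = ∀I (∀I (∀I (∀I (⇒I (⇒I (⇒I (⇒I (⇒I (⇒I
  (∃E h5 (∃I v0 (≐-sym (cancel-common-prefix h0 h5 h4 h3 h2 h1)))))))))))))

module _ {n : ℕ} {Γ : List (Formula n)} where
  B-cancel-common-prefix : ∀ {x₁ y₁ x₂ y₂} → Γ ⊢ x₁ B y₁ → Γ ⊢ LeftCancellable x₁ →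
    Γ ⊢ CommutesWithB x₁ → Γ ⊢ CommutesWithB y₁ → Γ ⊢ InBicommutantOfB y₂ →
    Γ ⊢ x₁ * x₂ ≐ y₁ * (y₂ * b) → Γ ⊢ (y₂ * b) B x₂
  B-cancel-common-prefix {x₁} {y₁} {x₂} {y₂} d lc cx₁ cy₁ bic eq =
    ⇒E (⇒E (⇒E (⇒E (⇒E (⇒E (instantiate ⊢cancel-common-prefix (∅ₛ ▸ x₁ ▸ y₁ ▸ x₂ ▸ y₂))
      d) lc) cx₁) cy₁) bic) eq

module _ {n : ℕ} {Γ : List (Formula n)} where
  addtally-b-left : ∀ {x y z} → Γ ⊢ Tallyb y → Γ ⊢ CommutesWithB y → Γ ⊢ x ≐ b → Γ ⊢ z ≐ y →
                    Γ ⊢ z * b ≐ x * y ∧ ¬' (z ≐ a)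
  addtally-b-left ty cy x≐b z≐y =
    ∧I (*-congʳ z≐y ⟫ ≐-sym cy ⟫ *-congʳ (≐-sym x≐b))
       (app-subst (¬' (v0 ≐ a)) (≐-sym z≐y) (tally-≢a ty))

  addtally-b-right : ∀ {x y z} → Γ ⊢ Tallyb x → Γ ⊢ y ≐ b → Γ ⊢ z ≐ x →
                     Γ ⊢ z * b ≐ x * y ∧ ¬' (z ≐ a)
  addtally-b-right tx y≐b z≐x =
    ∧I (*-cong z≐x (≐-sym y≐b))
       (app-subst (¬' (v0 ≐ a)) (≐-sym z≐x) (tally-≢a tx))

  addtally-S-right : ∀ {x y z y₁} → Γ ⊢ Tallyb y₁ → Γ ⊢ y ≐ S y₁ → Γ ⊢ z ≐ x * y₁ →
                     Γ ⊢ z * b ≐ x * y ∧ ¬' (z ≐ a)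
  addtally-S-right {x} {y} {z} {y₁} ty₁ y≐Sy₁ z≐xy₁ =
    ∧I (*-congʳ z≐xy₁ ⟫ *-assoc x y₁ b ⟫ *-congˡ (≐-sym (S≐*b (tally-≢a ty₁)) ⟫ ≐-sym y≐Sy₁))
       (⇒I (*≐a-elim (≐-sym (weaken₁ z≐xy₁) ⟫ h0)))

  addtally-a : ∀ {x y z w φ} → Γ ⊢ x ≐ a → Γ ⊢ Addtally x y z → Γ ⊢ z ≐ S w → Γ ⊢ ¬' (w ≐ a) → Γ ⊢ φ
  addtally-a x≐a sum z≐Sw w≢a = ∨E sum
    (tally-excludes-a (∧E₁ h0) (∨I₁ ≐refl) (weaken₁ x≐a))
    (*≐b-elim (≐-sym (S≐*b (weaken₁ w≢a)) ⟫ ≐-sym (weaken₁ z≐Sw) ⟫ ∧E₂ h0))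

⊢addtally-*b : QT⁺⊢ ∀' (∀' (∀' (Tallyb v2 ⇒ Tallyb v1 ⇒ CommutesWithB v1 ⇒ Addtally v2 v1 v0
                               ⇒ v0 * b ≐ v2 * v1 ∧ ¬' (v0 ≐ a))))
⊢addtally-*b = ∀I (∀I (∀I (⇒I (⇒I (⇒I (⇒I (∨E h0
  (∨E (∧E₂ (∧E₂ h0))
     (addtally-b-left h4 h3 (∧E₁ h0) (∧E₂ h0))
     (∨E h0
        (addtally-b-right (∧E₁ h2) (∧E₁ h0) (∧E₂ h0))
        (∃E h0 (∃E h0
          (addtally-S-right (∧E₁ (∧E₂ (∧E₂ h0))) (∧E₁ (∧E₂ (∧E₂ (∧E₂ h0)))) (∧E₂ (∧E₂ (∧E₂ (∧E₂ h0)))))))))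
  (∨E (∧E₁ h0) (¬'-elim h0 h5) (¬'-elim h0 h4)))))))))

module _ {n : ℕ} {Γ : List (Formula n)} where
  addtally-*b : ∀ {x y z} → Γ ⊢ Tallyb x → Γ ⊢ Tallyb y → Γ ⊢ CommutesWithB y → Γ ⊢ Addtally x y z →
                Γ ⊢ z * b ≐ x * y ∧ ¬' (z ≐ a)
  addtally-*b {x} {y} {z} tx ty cy sum =
    ⇒E (⇒E (⇒E (⇒E (instantiate ⊢addtally-*b (∅ₛ ▸ x ▸ y ▸ z)) tx) ty) cy) sum

Admissible : ∀ {n} → Term n → Formula n
Admissible x = Good x ∧ I₀ x ∧ I₀ (x * b)

module _ {n : ℕ} {Γ : List (Formula n)} where
  S≤-from-addtally : ∀ {x₂ y₁ y₂ x₁ z₁ z₂} →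
    Γ ⊢ Admissible x₂ → Γ ⊢ Admissible y₁ → Γ ⊢ Admissible y₂ →
    Γ ⊢ Tallyb x₂ → Γ ⊢ Tallyb y₁ → Γ ⊢ Tallyb y₂ →
    Γ ⊢ Addtally x₁ x₂ z₁ → Γ ⊢ Addtally y₁ y₂ z₂ → Γ ⊢ x₁ ≤' y₁ → Γ ⊢ z₁ ≐ S z₂ →
    Γ ⊢ S y₂ ≤' x₂
  S≤-from-addtally {x₂} {y₁} {y₂} {x₁} {z₁} {z₂}
                   adm-x₂ adm-y₁ adm-y₂ tally-x₂ tally-y₁ tally-y₂ sum₁ sum₂ x₁≤y₁ z₁≐Sz₂ =
    cases x₁≤y₁ (⇒I (cases (∧E₂ (∧E₂ h0)) (weaken₁ x₁≐a-case) (weaken₁ x₁By₁-case))) x₁≐y₁-case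
    where
    good-y₁ : Γ ⊢ Good y₁
    good-y₁ = ∧E₁ adm-y₁

    comm-y₁ : Γ ⊢ CommutesWithB y₁
    comm-y₁ = good-tally-commutesWithB good-y₁ tally-y₁

    sum₂-spec : Γ ⊢ z₂ * b ≐ y₁ * y₂ ∧ ¬' (z₂ ≐ a)
    sum₂-spec = addtally-*b tally-y₁ tally-y₂ (good-tally-commutesWithB (∧E₁ adm-y₂) tally-y₂) sum₂

    Sy₂≐y₂b : Γ ⊢ S y₂ ≐ y₂ * b
    Sy₂≐y₂b = S≐*b (tally-≢a tally-y₂)

    z₁b≐y₁y₂b : Γ ⊢ z₁ * b ≐ y₁ * (y₂ * b)
    z₁b≐y₁y₂b = *-congʳ (z₁≐Sz₂ ⟫ S≐*b (∧E₂ sum₂-spec)) ⟫ *-congʳ (∧E₁ sum₂-spec) ⟫ *-assoc y₁ y₂ b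

    sums-equal : Γ ⊢ Tallyb x₁ ⇒ x₁ * x₂ ≐ y₁ * (y₂ * b)
    sums-equal = ⇒I
      (≐-sym (∧E₁ (addtally-*b h0 (weaken₁ tally-x₂)
                               (weaken₁ (good-tally-commutesWithB (∧E₁ adm-x₂) tally-x₂)) (weaken₁ sum₁)))
       ⟫ weaken₁ z₁b≐y₁y₂b)

    x₁≐y₁-case : Γ ⊢ x₁ ≐ y₁ ⇒ S y₂ ≤' x₂
    x₁≐y₁-case = ⇒I (∨I₂ (weaken₁ Sy₂≐y₂b ⟫ ≐-sym x₂≐y₂b))
      where
      x₂≐y₂b : ((x₁ ≐ y₁) ∷ Γ) ⊢ x₂ ≐ y₂ * b
      x₂≐y₂b = left-cancel (weaken₁ (∧E₁ (good-tame good-y₁ (∨I₁ ≐refl))))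
        (*-congʳ (≐-sym h0) ⟫ ⇒E (weaken₁ sums-equal) (app-subst (Tallyb v0) (≐-sym h0) (weaken₁ tally-y₁)))

    x₁≐a-case : Γ ⊢ x₁ ≐ a ∧ ¬' (y₁ ≐ a) ⇒ S y₂ ≤' x₂
    x₁≐a-case = ⇒I (addtally-a (∧E₁ h0) (weaken₁ sum₁) (weaken₁ z₁≐Sz₂) (weaken₁ (∧E₂ sum₂-spec)))

    x₁By₁-case : Γ ⊢ x₁ B y₁ ⇒ S y₂ ≤' x₂
    x₁By₁-case = ⇒I (∨I₁ (∧I (app-subst I₀F (weaken₁ (≐-sym Sy₂≐y₂b)) (weaken₁ (∧E₂ (∧E₂ adm-y₂))))
                        (∧I (weaken₁ (∧E₁ (∧E₂ adm-x₂)))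
                            (∨I₂ (B-respˡ (weaken₁ Sy₂≐y₂b) y₂b-B-x₂)))))
      where
      tally-x₁ : ((x₁ B y₁) ∷ Γ) ⊢ Tallyb x₁
      tally-x₁ = tally-B h0 (weaken₁ tally-y₁)
      tame-x₁ : ((x₁ B y₁) ∷ Γ) ⊢ Tame x₁
      tame-x₁ = good-tame (weaken₁ good-y₁) (∨I₂ h0)
      y₂b-B-x₂ : ((x₁ B y₁) ∷ Γ) ⊢ (y₂ * b) B x₂
      y₂b-B-x₂ = B-cancel-common-prefix h0 (∧E₁ tame-x₁) (⇒E (∧E₂ tame-x₁) tally-x₁) (weaken₁ comm-y₁)
        (⇒E (∧E₂ (weaken₁ (∧E₁ adm-y₂))) (weaken₁ tally-y₂)) (⇒E (weaken₁ sums-equal) tally-x₁)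

thm7Body-from-admissible : ∀ {Γ : List (Formula 6)} →
  Γ ⊢ Admissible v5 → Γ ⊢ Admissible v4 → Γ ⊢ Admissible v3 → Γ ⊢ thm7Body
thm7Body-from-admissible x₂ y₁ y₂ = ⇒I (S≤-from-addtally (weaken₁ x₂) (weaken₁ y₁) (weaken₁ y₂)
  (∧E₁ h0) (∧E₁ (∧E₂ h0)) (∧E₁ (∧E₂ (∧E₂ h0))) (∧E₁ (∧E₂ (∧E₂ (∧E₂ h0))))
  (∧E₁ (∧E₂ (∧E₂ (∧E₂ (∧E₂ h0))))) (∧E₁ (∧E₂ (∧E₂ (∧E₂ (∧E₂ (∧E₂ h0))))))
  (∧E₂ (∧E₂ (∧E₂ (∧E₂ (∧E₂ (∧E₂ h0)))))))

admissible : ∀ {n} {Γ : List (Formula n)} {I t} → QT⁺⊢ ∀' (I ⇒ app I (v0 * b)) → I ⊆ I₀F →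
             Γ ⊢ app I t ∧ Good t → Γ ⊢ Admissible t
admissible {I = I} I-*b I⊆I₀ d =
  ∧I (∧E₂ d) (∧I (app-⇒ I⊆I₀ (∧E₁ d))
                 (app-⇒ I⊆I₀ (subst (_ ⊢_) (subF-fuse (λ _ → refl) I) (app-⇒ I-*b (∧E₁ d)))))

mainTheorem7 : (I : Formula 1) → IsStringForm I → I ⊆ I₀F →
    Σ (Formula 1) (λ J → IsStringForm J × J ⊆ I × (QT⁺⊢ thm7Sentence J))
mainTheorem7 I (I-a , I-b , I-*a , I-*b) I⊆I₀ =
  I ∧ Good v0 , stringForm , ∀I (⇒I (∧E₁ h0)) , theorem7
  where
  stringForm : IsStringForm (I ∧ Good v0)
  stringForm = ∧I I-a ⊢good-a , ∧I I-b ⊢good-b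
             , ∀I (⇒I (∧I (⇒E (∀-open I-*a) (∧E₁ h0)) (⇒E (∀-open ⊢good-*a) (∧E₂ h0))))
             , ∀I (⇒I (∧I (⇒E (∀-open I-*b) (∧E₁ h0)) (⇒E (∀-open ⊢good-*b) (∧E₂ h0))))

  theorem7 : QT⁺⊢ thm7Sentence (I ∧ Good v0)
  theorem7 =
    ∀I (⇒I (cut (admissible I-*b I⊆I₀ h0)
    (∀I (⇒I (cut (admissible I-*b I⊆I₀ h0)
    (∀I (⇒I (cut (admissible I-*b I⊆I₀ h0)
    (∀I (∀I (∀I (thm7Body-from-admissible h4 h2 h0))))))))))))
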